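{- Let $\mathcal{H}\subseteq 2^V$ be a hypergraph. For all positions $\mathbf{x},\mathbf{x}'\in\mathbb{Z}_+^V$ we have $h_\mathcal{H}(\mathbf{x})\geq h_\mathcal{H}(\mathbf{x}')-\|\mathbf{x}'-\mathbf{x}\|_+$. In particular, $h_\mathcal{H}$ is monotone: $\mathbf{x}\geq\mathbf{x}'$ componentwise implies $h_\mathcal{H}(\mathbf{x})\geq h_\mathcal{H}(\mathbf{x}')$.
   Context: A hypergraph on a finite set $V$ is a family $\mathcal{H}\subseteq 2^V$ of nonempty edges covering $V$. In Nim$_\mathcal{H}$ a move from $\mathbf{x}\in\mathbb{Z}_+^V$ chooses $H\in\mathcal{H}$ and strictly decreases all $x_i$, $i\in H$, leaving other coordinates unchanged (values stay nonnegative). The height $h_\mathcal{H}(\mathbf{x})$ is the maximum number of consecutive moves that can be made from $\mathbf{x}$. $\|\mathbf{x}'-\mathbf{x}\|_+=\sum_{i:\,x'_i>x_i}(x'_i-x_i)$. -}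

module Defs where

open import Data.Nat using (ℕ; zero; suc; _+_; _∸_; _<_; _≤_)
open import Data.Fin using (Fin)
open import Data.Fin.Subset using (Subset; _∈_; _∉_; Nonempty)
open import Data.List using (List; map; allFin)
open import Data.Nat.ListAction using (sum)
open import Data.List.Membership.Propositional using () renaming (_∈_ to _∈ₗ_)
open import Data.Product using (Σ; ∃; _×_)
open import Relation.Binary.PropositionalEquality using (_≡_)

Pos : ℕ → Set
Pos n = Fin n → ℕ

Hypergraph : ℕ → Set
Hypergraph n = List (Subset n)

IsHypergraph : ∀ {n} → Hypergraph n → Set
IsHypergraph {n} 𝓗 =
  (∀ {H} → H ∈ₗ 𝓗 → Nonempty H) × (∀ (i : Fin n) → ∃ λ H → H ∈ₗ 𝓗 × i ∈ H)

MoveBy : ∀ {n} → Subset n → Pos n → Pos n → Set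
MoveBy {n} H x y = ∀ (i : Fin n) → (i ∈ H → y i < x i) × (i ∉ H → y i ≡ x i)

Move : ∀ {n} → Hypergraph n → Pos n → Pos n → Set
Move 𝓗 x y = ∃ λ H → H ∈ₗ 𝓗 × MoveBy H x y

data Play {n} (𝓗 : Hypergraph n) : ℕ → Pos n → Set where
  stop : ∀ {x} → Play 𝓗 zero x
  step : ∀ {k x y} → Move 𝓗 x y → Play 𝓗 k y → Play 𝓗 (suc k) x

IsHeight : ∀ {n} → Hypergraph n → Pos n → ℕ → Set
IsHeight 𝓗 x h = Play 𝓗 h x × (∀ k → Play 𝓗 k x → k ≤ h)

-- ‖x' − x‖₊ = Σ_{i : x'_i > x_i} (x'_i − x_i) = Σ_i (x'_i ∸ x_i)
norm+ : ∀ {n} → Pos n → Pos n → ℕ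
norm+ {n} x' x = sum (map (λ i → x' i ∸ x i) (allFin n))

-- A play from x' can be shadowed from x.  When x' moves along H to y', either some
-- i ∈ H already has x i ≤ y' i, so the move merely shrinks ‖x' − x‖₊ by at least one
-- while x stays put; or every coordinate of H in x is above its new value, and x makes
-- the same move, decreasing each x i by the amount x' i dropped (truncated at 0), which
-- does not increase the distance.  Hence k moves from x' give k ∸ ‖x' − x‖₊ moves from x.
module Submission where

open import Defs
open import Data.Nat using (ℕ; zero; suc; _+_; _∸_; _≤_; _<_; z≤n; s≤s; _≤?_)
open import Data.Nat.Properties
open import Data.Nat.ListAction using (sum)
open import Data.Fin.Subset using (Subset; _∈_)
open import Data.Fin.Subset.Properties using (_∈?_)
open import Data.Fin.Properties using (any?)
open import Data.List using (List; []; _∷_; map; allFin)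
open import Data.List.Relation.Unary.Any using (here; there)
open import Data.List.Membership.Propositional using () renaming (_∈_ to _∈ₗ_)
open import Data.List.Membership.Propositional.Properties using (∈-allFin)
open import Data.Product using (_×_; _,_; proj₁; proj₂)
open import Relation.Nullary using (yes; no)
open import Relation.Nullary.Decidable using (_×-dec_)
open import Relation.Binary.PropositionalEquality using (_≡_; refl; sym; cong; trans)

private
  variable
    n k m : ℕ
    A : Set

sum-map-mono-≤ : {f g : A → ℕ} (xs : List A) → (∀ a → f a ≤ g a) →
                 sum (map f xs) ≤ sum (map g xs)
sum-map-mono-≤ []       f≤g = z≤n
sum-map-mono-≤ (a ∷ xs) f≤g = +-mono-≤ (f≤g a) (sum-map-mono-≤ xs f≤g)

sum-map-mono-< : {f g : A → ℕ} (xs : List A) → (∀ a → f a ≤ g a) →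
                 ∀ {b} → b ∈ₗ xs → f b < g b → sum (map f xs) < sum (map g xs)
sum-map-mono-< (a ∷ xs) f≤g (here refl) fb<gb = +-mono-<-≤ fb<gb (sum-map-mono-≤ xs f≤g)
sum-map-mono-< (a ∷ xs) f≤g (there b∈xs) fb<gb =
  +-mono-≤-< (f≤g a) (sum-map-mono-< xs f≤g b∈xs fb<gb)

sum-map-≡0 : {f : A → ℕ} (xs : List A) → (∀ a → f a ≡ 0) → sum (map f xs) ≡ 0
sum-map-≡0          []       f≡0 = refl
sum-map-≡0 {f = f} (a ∷ xs) f≡0 = trans (cong (_+ sum (map f xs)) (f≡0 a)) (sum-map-≡0 xs f≡0)

[m∸o]∸[n∸o]≤m∸n : ∀ m n o → (m ∸ o) ∸ (n ∸ o) ≤ m ∸ n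
[m∸o]∸[n∸o]≤m∸n m       n       zero    = ≤-refl
[m∸o]∸[n∸o]≤m∸n m       zero    (suc o) = m∸n≤m m (suc o)
[m∸o]∸[n∸o]≤m∸n zero    (suc n) (suc o) = ≤-reflexive (0∸n≡0 (n ∸ o))
[m∸o]∸[n∸o]≤m∸n (suc m) (suc n) (suc o) = [m∸o]∸[n∸o]≤m∸n m n o

m∸n<m : ∀ m n → 0 < m → 0 < n → m ∸ n < m
m∸n<m (suc m) (suc n) _ _ = s≤s (m∸n≤m m n)

1+m∸n≤1+[m∸n] : ∀ m n → suc m ∸ n ≤ suc (m ∸ n)
1+m∸n≤1+[m∸n] m       zero    = ≤-refl
1+m∸n≤1+[m∸n] zero    (suc n) = ≤-trans (≤-reflexive (0∸n≡0 n)) z≤n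
1+m∸n≤1+[m∸n] (suc m) (suc n) = 1+m∸n≤1+[m∸n] m n

norm+-mono-≤ : {x x' y y' : Pos n} → (∀ i → y' i ∸ y i ≤ x' i ∸ x i) →
               norm+ y' y ≤ norm+ x' x
norm+-mono-≤ {n} = sum-map-mono-≤ (allFin n)

norm+-≡0 : {x x' : Pos n} → (∀ i → x' i ≤ x i) → norm+ x' x ≡ 0
norm+-≡0 {n} x'≤x = sum-map-≡0 (allFin n) (λ i → m≤n⇒m∸n≡0 (x'≤x i))

MoveBy⇒≤ : ∀ {H : Subset n} {x y} → MoveBy H x y → ∀ i → y i ≤ x i
MoveBy⇒≤ {H = H} x→y i with i ∈? H
... | yes i∈H = <⇒≤ (proj₁ (x→y i) i∈H)
... | no  i∉H = ≤-reflexive (proj₂ (x→y i) i∉H)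

norm+-MoveBy-< : ∀ {H : Subset n} {x' y'} (x : Pos n) → MoveBy H x' y' →
                 ∀ {j} → j ∈ H → x j ≤ y' j → norm+ y' x < norm+ x' x
norm+-MoveBy-< {n} x x'→y' j∈H xj≤y'j =
  sum-map-mono-< (allFin n) (λ i → ∸-monoˡ-≤ (x i) (MoveBy⇒≤ x'→y' i))
    (∈-allFin _) (∸-monoˡ-< (proj₁ (x'→y' _) j∈H) xj≤y'j)

shadow : Pos n → Pos n → Pos n → Pos n
shadow x x' y' i = x i ∸ (x' i ∸ y' i)

MoveBy-shadow : ∀ {H : Subset n} {x' y'} (x : Pos n) → MoveBy H x' y' →
                (∀ {i} → i ∈ H → y' i < x i) → MoveBy H x (shadow x x' y')
MoveBy-shadow {x' = x'} {y'} x x'→y' y'<x i =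
    (λ i∈H → m∸n<m (x i) (x' i ∸ y' i) (m<n⇒0<n (y'<x i∈H)) (m<n⇒0<n∸m (proj₁ (x'→y' i) i∈H)))
  , (λ i∉H → cong (x i ∸_) (trans (cong (x' i ∸_) (proj₂ (x'→y' i) i∉H)) (n∸n≡0 (x' i))))

norm+-shadow-≤ : ∀ {H : Subset n} {x' y'} (x : Pos n) → MoveBy H x' y' →
                 norm+ y' (shadow x x' y') ≤ norm+ x' x
norm+-shadow-≤ {x' = x'} {y'} x x'→y' = norm+-mono-≤ {x = x} {x'} {shadow x x' y'} {y'} λ i →
  ≤-trans (≤-reflexive (cong (_∸ shadow x x' y' i) (sym (m∸[m∸n]≡n (MoveBy⇒≤ x'→y' i)))))
          ([m∸o]∸[n∸o]≤m∸n (x' i) (x i) (x' i ∸ y' i))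

play-shorten : ∀ {𝓗 : Hypergraph n} {x} → m ≤ k → Play 𝓗 k x → Play 𝓗 m x
play-shorten z≤n       _           = stop
play-shorten (s≤s m≤k) (step mv p) = step mv (play-shorten m≤k p)

play-transfer : ∀ {𝓗 : Hypergraph n} {x'} → Play 𝓗 k x' → ∀ x → Play 𝓗 (k ∸ norm+ x' x) x
play-transfer {x' = x'} stop x = play-shorten (≤-reflexive (0∸n≡0 (norm+ x' x))) stop
play-transfer {k = suc k} {x' = x'} (step {y = y'} (H , H∈𝓗 , x'→y') p) x
  with any? (λ i → (i ∈? H) ×-dec (x i ≤? y' i))
... | yes (j , j∈H , xj≤y'j) =
  play-shorten (∸-monoʳ-≤ (suc k) (norm+-MoveBy-< x x'→y' j∈H xj≤y'j)) (play-transfer p x)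
... | no ∄j =
  play-shorten (≤-trans (∸-monoʳ-≤ (suc k) norm+y'y≤norm+x'x) (1+m∸n≤1+[m∸n] k (norm+ y' y)))
    (step (H , H∈𝓗 , MoveBy-shadow {x' = x'} x x'→y' y'<x) (play-transfer p y))
  where
  y : Pos _
  y = shadow x x' y'
  y'<x : ∀ {i} → i ∈ H → y' i < x i
  y'<x {i} i∈H = ≰⇒> (λ xi≤y'i → ∄j (i , i∈H , xi≤y'i))
  norm+y'y≤norm+x'x : norm+ y' y ≤ norm+ x' x
  norm+y'y≤norm+x'x = norm+-shadow-≤ x x'→y'

height-bound : ∀ {𝓗 : Hypergraph n} (x x' : Pos n) (h h' : ℕ) →
               IsHeight 𝓗 x h → IsHeight 𝓗 x' h' → h' ≤ h + norm+ x' x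
height-bound x x' h h' (_ , maximal) (play' , _) = begin
  h'                             ≤⟨ m≤n+m∸n h' (norm+ x' x) ⟩
  norm+ x' x + (h' ∸ norm+ x' x) ≤⟨ +-monoʳ-≤ (norm+ x' x) (maximal _ (play-transfer play' x)) ⟩
  norm+ x' x + h                 ≡⟨ +-comm (norm+ x' x) h ⟩
  h + norm+ x' x                 ∎
  where open ≤-Reasoning

height-mono : ∀ {𝓗 : Hypergraph n} (x x' : Pos n) (h h' : ℕ) →
              IsHeight 𝓗 x h → IsHeight 𝓗 x' h' → (∀ i → x' i ≤ x i) → h' ≤ h
height-mono x x' h h' hx hx' x'≤x = begin
  h'              ≤⟨ height-bound x x' h h' hx hx' ⟩
  h + norm+ x' x  ≡⟨ cong (h +_) (norm+-≡0 x'≤x) ⟩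
  h + 0           ≡⟨ +-identityʳ h ⟩
  h               ∎
  where open ≤-Reasoning

lemma1 : ∀ {n} (𝓗 : Hypergraph n) → IsHypergraph 𝓗 →
           (∀ (x x' : Pos n) (h h' : ℕ) → IsHeight 𝓗 x h → IsHeight 𝓗 x' h' →
              h' ≤ h + norm+ x' x)
           × (∀ (x x' : Pos n) (h h' : ℕ) → IsHeight 𝓗 x h → IsHeight 𝓗 x' h' →
              (∀ i → x' i ≤ x i) → h' ≤ h)
lemma1 𝓗 _ = height-bound , height-mono
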